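{- Let $n\in\mathbb N$ and for $k\in\mathbb N$ let $R_k=\{p\in\beta S_0:\ \forall B\in p\ \exists w\in S_k \text{ with } \{w(\vec x):\vec x\in\mathbb A^k\}\subseteq B\}$. Then $R_{n+1}\subseteq R_n$.
   Context: $\mathbb A$ is a fixed nonempty finite alphabet, $S_0=\mathbb A^+$ the free semigroup of nonempty words over $\mathbb A$, $v_1,v_2,\dots$ distinct variables not in $\mathbb A$, and $S_k$ the set of nonempty words over $\mathbb A\cup\{v_1,\dots,v_k\}$ in which every $v_i$ ($i\le k$) occurs. For $\vec x=(x_1,\dots,x_k)\in\mathbb A^k$, $w(\vec x)$ replaces each occurrence of $v_i$ in $w$ by $x_i$. $\beta S_0$ is the set of ultrafilters on $S_0$ (the Stone–Čech compactification). -}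

module Defs where

open import Level using (0ℓ)
open import Data.Nat using (ℕ; suc)
open import Data.Fin using (Fin)
open import Data.Sum using (_⊎_; inj₁; inj₂; [_,_])
open import Data.Product using (Σ; _×_; ∃)
open import Data.Unit using (⊤)
open import Data.Empty using (⊥)
open import Data.List.NonEmpty using (List⁺; toList) renaming (map to map⁺)
open import Data.List.Membership.Propositional using (_∈_)
open import Relation.Nullary using (¬_)
open import Relation.Unary using (Pred; _⊆_; _∩_; ∁)

record Ultrafilter (X : Set) : Set₁ where
  field
    member  : Pred X 0ℓ → Set
    whole   : member (λ _ → ⊤)
    proper  : ¬ member (λ _ → ⊥)
    upward  : ∀ {B C : Pred X 0ℓ} → B ⊆ C → member B → member C
    meet    : ∀ {B C : Pred X 0ℓ} → member B → member C → member (B ∩ C)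
    ultra   : ∀ (B : Pred X 0ℓ) → member B ⊎ member (∁ B)
open Ultrafilter public

-- The alphabet 𝔸 is Fin (suc m): a nonempty finite set.
Alph : ℕ → Set
Alph m = Fin (suc m)

S₀ : ℕ → Set
S₀ m = List⁺ (Alph m)

βS₀ : ℕ → Set₁
βS₀ m = Ultrafilter (S₀ m)

-- Nonempty words over 𝔸 ∪ {v₁,…,v_k}; the variable v_(i+1) is inj₂ i.
Word : ℕ → ℕ → Set
Word m k = List⁺ (Alph m ⊎ Fin k)

InS : ∀ {m} k → Word m k → Set
InS k w = ∀ (i : Fin k) → inj₂ i ∈ toList w

subst : ∀ {m k} → Word m k → (Fin k → Alph m) → S₀ m
subst w x = map⁺ [ (λ a → a) , x ] w

R : ∀ {m} → ℕ → βS₀ m → Set₁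
R {m} k p = ∀ (B : Pred (S₀ m) 0ℓ) → member p B →
  Σ (Word m k) (λ w → InS k w × (∀ (x : Fin k → Alph m) → B (subst w x)))

-- Substituting a fixed letter for v₁ (and renaming v_(i+1) to v_i) turns a word of S_(n+1)
-- into one of S_n with exactly the same instances, namely those instances of the old word
-- whose first coordinate is that letter.
module Submission where

open import Defs
open import Data.Nat using (ℕ; suc)
open import Data.Fin using (Fin; zero; suc)
open import Data.Sum using (_⊎_; inj₁; inj₂; [_,_])
open import Function using (_∘′_)
open import Data.Product using (_,_)
open import Data.Vec.Functional using (_∷_)
open import Data.List.NonEmpty using () renaming (map to map⁺)
open import Data.List.NonEmpty.Properties using (map-∘; map-cong)
open import Data.List.Membership.Propositional.Properties using (∈-map⁺)
open import Relation.Binary.PropositionalEquality using (_≡_; refl; sym; trans; _≗_) renaming (subst to transport)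

module _ {m k : ℕ} where

  instantiateFirst : Alph m → Alph m ⊎ Fin (suc k) → Alph m ⊎ Fin k
  instantiateFirst a (inj₁ b)       = inj₁ b
  instantiateFirst a (inj₂ zero)    = inj₁ a
  instantiateFirst a (inj₂ (suc i)) = inj₂ i

  instantiateFirst-InS : ∀ a (w : Word m (suc k)) →
                         InS (suc k) w → InS k (map⁺ (instantiateFirst a) w)
  instantiateFirst-InS a w w∈S i = ∈-map⁺ (instantiateFirst a) (w∈S (suc i))

  letter-instantiateFirst : ∀ a (x : Fin k → Alph m) →
    [ (λ b → b) , x ] ∘′ instantiateFirst a ≗ [ (λ b → b) , a ∷ x ]
  letter-instantiateFirst a x (inj₁ b)       = refl
  letter-instantiateFirst a x (inj₂ zero)    = refl
  letter-instantiateFirst a x (inj₂ (suc i)) = refl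

  subst-instantiateFirst : ∀ a (w : Word m (suc k)) (x : Fin k → Alph m) →
    subst (map⁺ (instantiateFirst a) w) x ≡ subst w (a ∷ x)
  subst-instantiateFirst a w x =
    trans (sym (map-∘ w)) (map-cong (letter-instantiateFirst a x) w)

theorem5p5 : ∀ (m n : ℕ) (p : βS₀ m) → R (suc n) p → R n p
theorem5p5 m n p p∈R B B∈p with p∈R B B∈p
... | w , w∈S , w⊆B =
  map⁺ (instantiateFirst zero) w ,
  instantiateFirst-InS zero w w∈S ,
  λ x → transport B (sym (subst-instantiateFirst zero w x)) (w⊆B (zero ∷ x))
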